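{- Consider a 0-1 knapsack instance with capacity $c$ and $n$ items with weights $w_1 \ge w_2 \ge \cdots \ge w_n$ (all parameters strictly positive integers, $\sum_{i=1}^n w_i > c$, and $w_i \le c$ for all $i$). Let $X$ be the set of inclusionwise maximal solutions, and for $1\le k\le c$ let $\text{numberIMSWeight}(k)=|\{\mathbf{x}\in X : \sum_{j=1}^n w_j x_j = k\}|$. For $1\le i\le n$ and $k\in\mathbb{Z}$ let $\text{numberSubsetsWeight}(i,k)$ be the number of subsets $A\subseteq\{1,\ldots,i-1\}$ with $\sum_{j\in A} w_j = k$. Then for every $k$ with $1\le k\le c$, $$\text{numberIMSWeight}(k)=\sum_{i=1}^{n} \begin{cases}\text{numberSubsetsWeight}\big(i,\,k-\sum_{j=i+1}^{n} w_j\big) & \text{if } c+1-w_i\le k\le c,\\ 0 & \text{otherwise.}\end{cases}$$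
   Context: A solution is a vector $\mathbf{x}\in\{0,1\}^n$. A solution $\mathbf{x}$ is inclusionwise maximal if $\sum_{i=1}^n w_i x_i \le c$ and there is no index $j$ with $x_j=0$ and $w_j+\sum_{i=1}^n w_i x_i \le c$. -}

module Defs where

open import Data.Nat using (ℕ; zero; suc; _+_; _≤_; _≤?_; _<ᵇ_)
open import Data.Bool using (Bool; true; false; if_then_else_)
open import Data.Fin using (Fin; zero; suc; toℕ; Fin′; inject)
open import Data.Fin.Properties using (all?)
open import Data.List using (List; []; _∷_; map; _++_; length; filter)
open import Data.Product using (_×_; _,_)
open import Data.Integer as ℤ using (ℤ; +_; _-_)
open import Relation.Nullary using (¬_; Dec; yes; no)
open import Relation.Nullary.Decidable using (_×-dec_; ¬?)
open import Relation.Binary.PropositionalEquality using (_≡_)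
open import Data.Bool.Properties using () renaming (_≟_ to _≟ᵇ_)
open import Relation.Unary using (Decidable)

sumFin : ∀ {n} → (Fin n → ℕ) → ℕ
sumFin {zero}  f = 0
sumFin {suc n} f = f zero + sumFin (λ i → f (suc i))

allVectors : (n : ℕ) → List (Fin n → Bool)
allVectors zero    = (λ ()) ∷ []
allVectors (suc n) =
  map (λ x → λ { zero → false ; (suc i) → x i }) (allVectors n) ++
  map (λ x → λ { zero → true  ; (suc i) → x i }) (allVectors n)

weight : ∀ {n} → (Fin n → ℕ) → (Fin n → Bool) → ℕ
weight w x = sumFin (λ i → if x i then w i else 0)

IsIMS : ∀ {n} → (Fin n → ℕ) → ℕ → (Fin n → Bool) → Set
IsIMS w c x =
  weight w x ≤ c × (∀ j → x j ≡ false → ¬ (w j + weight w x ≤ c))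

IsIMS? : ∀ {n} (w : Fin n → ℕ) (c : ℕ) → Decidable (IsIMS w c)
IsIMS? w c x =
  (weight w x ≤? c) ×-dec
  all? (λ j → imp (x j ≟ᵇ false) (¬? (w j + weight w x ≤? c)))
  where
  imp : ∀ {A B : Set} → Dec A → Dec B → Dec (A → B)
  imp _       (yes b) = yes (λ _ → b)
  imp (yes a) (no ¬b) = no (λ f → ¬b (f a))
  imp (no ¬a) (no _)  = yes (λ a → Data.Empty.⊥-elim (¬a a))
    where import Data.Empty

numberIMSWeight : ∀ {n} → (Fin n → ℕ) → ℕ → ℕ → ℕ
numberIMSWeight {n} w c k =
  length (filter (λ x → IsIMS? w c x ×-dec (weight w x Data.Nat.≟ k)) (allVectors n))
  where import Data.Nat

-- numberSubsetsWeight(i,k): number of subsets A ⊆ {items before i}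
-- (i.e. A ⊆ {1,…,i-1} in 1-based numbering) with Σ_{j∈A} w_j = k, k ∈ ℤ.
numberSubsetsWeight : ∀ {n} → (Fin n → ℕ) → Fin n → ℤ → ℕ
numberSubsetsWeight w i k =
  length (filter (λ A → (+ weight (λ j → w (inject {i = i} j)) A) ℤ.≟ k)
                 (allVectors (toℕ i)))

tailSum : ∀ {n} → (Fin n → ℕ) → Fin n → ℕ
tailSum w i = sumFin (λ j → if toℕ i <ᵇ toℕ j then w j else 0)

module Submission where

-- A solution of weight k ≤ c is inclusionwise maximal iff no item it omits fits, i.e. every omitted j
-- has w_j + k > c, equivalently c + 1 - w_j ≤ k.  As the weights are non-increasing, the items that do
-- not fit form an initial segment.  Classify such solutions by their last omitted item i: all items
-- after i are taken, and the items before i do not fit either, so they form an arbitrary subset of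
-- weight k - Σ_{j>i} w_j.  The solution omitting nothing weighs Σ w_j > c ≥ k and does not occur.

open import Defs
open import Data.Nat using (ℕ; _+_; _∸_; _≤_; _<_)
open import Data.Nat.Properties using () renaming (_≤?_ to _≤ℕ?_)
open import Data.Fin using (Fin; toℕ)
open import Data.Integer using (+_; _-_)
open import Data.Product using (_×_)
open import Relation.Nullary.Decidable using (⌊_⌋; _×-dec_)
open import Data.Bool using (if_then_else_)
open import Relation.Binary.PropositionalEquality using (_≡_)

open import Level using (Level)
open import Data.Nat using (zero; suc; s≤s; z≤n)
open import Data.Nat.Properties
  using (+-comm; +-identityʳ; <⇒≱; ≤-trans; +-monoˡ-≤; +-monoʳ-≤; ≰⇒>; m≤n+m∸n; m≤n+o⇒m∸n≤o; m+1+n≰m)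
open import Data.Nat.Tactic.RingSolver using (solve-∀)
open import Data.Fin using (inject) renaming (zero to fzero; suc to fsuc)
open import Data.Fin.Properties using (all?; ∀-cons)
open import Data.Integer as ℤ using (ℤ; 0ℤ)
open import Data.Integer.Properties as ℤₚ using (+-injective)
import Data.Integer.Tactic.RingSolver as ℤ-Solver
open import Data.Bool using (Bool; true; false)
open import Data.Bool.Properties using () renaming (_≟_ to _≟ᵇ_)
open import Data.List using (List; []; _∷_; _++_; map; length; filter)
open import Data.List.Properties using (length-++; filter-++; filter-none; filter-≐)
open import Data.List.Relation.Unary.All using (universal)
open import Data.Product using (_,_; proj₁; proj₂)
open import Function using (_∘_; _⇔_; mk⇔; Equivalence)
open import Relation.Nullary using (Dec; does; yes; no; ¬_)
open import Relation.Nullary.Decidable using (_→-dec_; ¬?; does-⇔; dec-false; isYes≗does)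
open import Relation.Unary using (Pred; Decidable)
open import Relation.Binary.PropositionalEquality using (refl; sym; trans; cong; cong₂; subst; module ≡-Reasoning)

open Equivalence using (to; from)

private
  variable
    a p q : Level
    A : Set a

count : {P : Pred A p} → Decidable P → List A → ℕ
count P? xs = length (filter P? xs)

indicator : {P : Set p} → Dec P → ℕ
indicator P? = if does P? then 1 else 0

indicator-⇔ : {P : Set p} {Q : Set q} → P ⇔ Q → (P? : Dec P) (Q? : Dec Q) → indicator P? ≡ indicator Q?
indicator-⇔ P⇔Q P? Q? = cong (λ b → if b then 1 else 0) (does-⇔ P⇔Q P? Q?)

count-⇔ : {P : Pred A p} {Q : Pred A q} (P? : Decidable P) (Q? : Decidable Q)
  → (∀ x → P x ⇔ Q x) → ∀ xs → count P? xs ≡ count Q? xs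
count-⇔ P? Q? P⇔Q xs =
  cong length (filter-≐ P? Q? ((λ {x} → to (P⇔Q x)) , (λ {x} → from (P⇔Q x))) xs)

count-none : {P : Pred A p} (P? : Decidable P) → (∀ x → ¬ P x) → ∀ xs → count P? xs ≡ 0
count-none P? ¬P xs = cong length (filter-none P? (universal ¬P xs))

count-[-] : {P : Pred A p} (P? : Decidable P) (x : A) → count P? (x ∷ []) ≡ indicator (P? x)
count-[-] P? x with does (P? x)
... | true  = refl
... | false = refl

count-++ : {P : Pred A p} (P? : Decidable P) (xs ys : List A)
  → count P? (xs ++ ys) ≡ count P? xs + count P? ys
count-++ P? xs ys = trans (cong length (filter-++ P? xs ys)) (length-++ (filter P? xs))

count-const-× : {P : Set p} {Q : Pred A q} (P? : Dec P) (Q? : Decidable Q) (xs : List A)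
  → count (λ x → P? ×-dec Q? x) xs ≡ (if does P? then count Q? xs else 0)
count-const-× (yes p) Q? xs = count-⇔ (λ x → yes p ×-dec Q? x) Q? (λ x → mk⇔ proj₂ (p ,_)) xs
count-const-× (no ¬p) Q? xs = count-none (λ x → no ¬p ×-dec Q? x) (λ _ → ¬p ∘ proj₁) xs

count-map : ∀ {b} {B : Set b} {P : Pred B p} (P? : Decidable P) (f : A → B) (xs : List A)
  → count P? (map f xs) ≡ count (P? ∘ f) xs
count-map P? f []       = refl
count-map P? f (x ∷ xs) with does (P? (f x))
... | true  = cong suc (count-map P? f xs)
... | false = count-map P? f xs

-- On the two halves of allVectors (suc n) a predicate of the shape x ↦ R (x 0) (x ∘ suc)
-- reduces to R false and R true; the cons maps there are anonymous and cannot be named.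
count-allVectors-suc : ∀ {n} {R : Bool → Pred (Fin n → Bool) p} (R? : ∀ b → Decidable (R b))
  → count (λ x → R? (x fzero) (x ∘ fsuc)) (allVectors (suc n))
    ≡ count (R? false) (allVectors n) + count (R? true) (allVectors n)
count-allVectors-suc {n = n} R? =
  trans (count-++ P? (map _ (allVectors n)) (map _ (allVectors n)))
        (cong₂ _+_ (count-map P? _ (allVectors n)) (count-map P? _ (allVectors n)))
  where
  P? = λ (x : Fin (suc n) → Bool) → R? (x fzero) (x ∘ fsuc)

sumFin-cong : ∀ {n} {f g : Fin n → ℕ} → (∀ i → f i ≡ g i) → sumFin f ≡ sumFin g
sumFin-cong {zero}  f≗g = refl
sumFin-cong {suc n} f≗g = cong₂ _+_ (f≗g fzero) (sumFin-cong (f≗g ∘ fsuc))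

sumFin-zero : ∀ {n} {f : Fin n → ℕ} → (∀ i → f i ≡ 0) → sumFin f ≡ 0
sumFin-zero {zero}  f≗0 = refl
sumFin-zero {suc n} f≗0 = cong₂ _+_ (f≗0 fzero) (sumFin-zero (f≗0 ∘ fsuc))

sumFin-+ : ∀ {n} (f g : Fin n → ℕ) → sumFin (λ i → f i + g i) ≡ sumFin f + sumFin g
sumFin-+ {zero}  f g = refl
sumFin-+ {suc n} f g = trans (cong (_+_ (f fzero + g fzero)) (sumFin-+ (f ∘ fsuc) (g ∘ fsuc)))
                             (interchange (f fzero) (g fzero) (sumFin (f ∘ fsuc)) (sumFin (g ∘ fsuc)))
  where
  interchange : ∀ a b c d → (a + b) + (c + d) ≡ (a + c) + (b + d)
  interchange = solve-∀

if-+ : ∀ (b : Bool) (x y : ℕ) → (if b then x + y else 0) ≡ (if b then x else 0) + (if b then y else 0)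
if-+ true  x y = refl
if-+ false x y = refl

x+y≡t⇔y≡t-x : ∀ (x y t : ℤ) → (x ℤ.+ y ≡ t) ⇔ (y ≡ t - x)
x+y≡t⇔y≡t-x x y t = mk⇔
  (λ eq → trans (sym (cancelˡ x y)) (cong (_- x) eq))
  (λ eq → trans (cong (ℤ._+_ x) eq) (cancelʳ x t))
  where
  cancelˡ : ∀ x y → (x ℤ.+ y) - x ≡ y
  cancelˡ = ℤ-Solver.solve-∀
  cancelʳ : ∀ x t → x ℤ.+ (t - x) ≡ t
  cancelʳ = ℤ-Solver.solve-∀

0≡t-x⇔x≡t : ∀ (x t : ℤ) → (0ℤ ≡ t - x) ⇔ (x ≡ t)
0≡t-x⇔x≡t x t = mk⇔
  (λ eq → trans (sym (ℤₚ.+-identityʳ x)) (from (x+y≡t⇔y≡t-x x 0ℤ t) eq))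
  (λ eq → to (x+y≡t⇔y≡t-x x 0ℤ t) (trans (ℤₚ.+-identityʳ x) eq))

numberSubsetsWeight-zero : ∀ {n} (w : Fin (suc n) → ℕ) (t : ℤ)
  → numberSubsetsWeight w fzero t ≡ indicator (+ 0 ℤ.≟ t)
numberSubsetsWeight-zero w t = count-[-] (λ _ → + 0 ℤ.≟ t) (λ ())

numberSubsetsWeight-suc : ∀ {n} (w : Fin (suc n) → ℕ) (i : Fin n) (t : ℤ)
  → numberSubsetsWeight w (fsuc i) t
    ≡ numberSubsetsWeight (w ∘ fsuc) i t + numberSubsetsWeight (w ∘ fsuc) i (t - + w fzero)
numberSubsetsWeight-suc w i t =
  trans (count-allVectors-suc R?)
        (cong (_+_ (numberSubsetsWeight (w ∘ fsuc) i t))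
              (count-⇔ (R? true) _ (λ A → x+y≡t⇔y≡t-x (+ w fzero) _ t) (allVectors (toℕ i))))
  where
  R? : ∀ b → Decidable _
  R? b A = + ((if b then w fzero else 0) + weight (λ j → w (fsuc (inject j))) A) ℤ.≟ t

OmitsOnly : ∀ {n} → Pred (Fin n) p → Pred (Fin n → Bool) p
OmitsOnly H x = ∀ j → x j ≡ false → H j

omitsOnly? : ∀ {n} {H : Pred (Fin n) p} → Decidable H → Decidable (OmitsOnly H)
omitsOnly? H? x = all? (λ j → (x j ≟ᵇ false) →-dec H? j)

HasWeightOmittingOnly : ∀ {n} → (Fin n → ℕ) → Pred (Fin n) p → ℤ → Pred (Fin n → Bool) p
HasWeightOmittingOnly w H k x = (+ weight w x ≡ k) × OmitsOnly H x

hasWeightOmittingOnly? : ∀ {n} (w : Fin n → ℕ) {H : Pred (Fin n) p} → Decidable H → ∀ k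
  → Decidable (HasWeightOmittingOnly w H k)
hasWeightOmittingOnly? w H? k x = (+ weight w x ℤ.≟ k) ×-dec omitsOnly? H? x

PrefixClosed : ∀ {n} → Pred (Fin n) p → Set p
PrefixClosed H = ∀ i j → toℕ i ≤ toℕ j → H j → H i

-- Counts the solutions that omit only H-items by their last omitted item i: every item after i is taken.
lastOmittedCount : ∀ {n} (w : Fin n → ℕ) {H : Pred (Fin n) p} → Decidable H → ℤ → ℕ
lastOmittedCount w H? k =
  sumFin (λ i → if does (H? i) then numberSubsetsWeight w i (k - + tailSum w i) else 0)

lastOmittedCount-none : ∀ {n} (w : Fin n → ℕ) {H : Pred (Fin n) p} (H? : Decidable H)
  → (∀ i → ¬ H i) → ∀ k → lastOmittedCount w H? k ≡ 0
lastOmittedCount-none w H? ¬H k =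
  sumFin-zero (λ i → cong (λ b → if b then numberSubsetsWeight w i (k - + tailSum w i) else 0)
                          (dec-false (H? i) (¬H i)))

lastOmittedCount-suc : ∀ {n} (w : Fin (suc n) → ℕ) {H : Pred (Fin (suc n)) p} (H? : Decidable H) (k : ℤ)
  → lastOmittedCount w H? k
    ≡ (if does (H? fzero) then indicator (+ sumFin (w ∘ fsuc) ℤ.≟ k) else 0)
      + (lastOmittedCount (w ∘ fsuc) (H? ∘ fsuc) k + lastOmittedCount (w ∘ fsuc) (H? ∘ fsuc) (k - + w fzero))
lastOmittedCount-suc w H? k =
  cong₂ _+_
    (cong (λ z → if does (H? fzero) then z else 0)
          (trans (numberSubsetsWeight-zero w (k - + sumFin (w ∘ fsuc)))
                 (indicator-⇔ (0≡t-x⇔x≡t (+ sumFin (w ∘ fsuc)) k) (+ 0 ℤ.≟ _) (+ sumFin (w ∘ fsuc) ℤ.≟ k))))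
    (trans (sumFin-cong split)
           (sumFin-+ (λ i → if does (H? (fsuc i)) then N i (k - + T i) else 0)
                     (λ i → if does (H? (fsuc i)) then N i ((k - + w fzero) - + T i) else 0)))
  where
  N = numberSubsetsWeight (w ∘ fsuc)
  T = tailSum (w ∘ fsuc)
  split : ∀ i → (if does (H? (fsuc i)) then numberSubsetsWeight w (fsuc i) (k - + T i) else 0)
              ≡ (if does (H? (fsuc i)) then N i (k - + T i) else 0)
                + (if does (H? (fsuc i)) then N i ((k - + w fzero) - + T i) else 0)
  split i = trans (cong (λ z → if does (H? (fsuc i)) then z else 0)
                        (trans (numberSubsetsWeight-suc w i (k - + T i))
                               (cong (λ t → N i (k - + T i) + N i t) (sub-comm k (+ T i) (+ w fzero)))))
                  (if-+ (does (H? (fsuc i))) _ _)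
    where
    sub-comm : ∀ t x y → (t - x) - y ≡ (t - y) - x
    sub-comm = ℤ-Solver.solve-∀

count-hasWeightOmittingOnly : ∀ {n} (w : Fin n → ℕ) {H : Pred (Fin n) p} (H? : Decidable H)
  → PrefixClosed H → (k : ℤ)
  → count (hasWeightOmittingOnly? w H? k) (allVectors n)
    ≡ indicator (+ sumFin w ℤ.≟ k) + lastOmittedCount w H? k
count-hasWeightOmittingOnly {n = zero} w H? closed k =
  trans (count-⇔ (hasWeightOmittingOnly? w H? k) (λ _ → + 0 ℤ.≟ k)
                 (λ x → mk⇔ proj₁ (λ eq → eq , λ ())) (allVectors 0))
        (trans (count-[-] (λ _ → + 0 ℤ.≟ k) (λ ())) (sym (+-identityʳ _)))
count-hasWeightOmittingOnly {n = suc n} w {H} H? closed k = begin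
  count (hasWeightOmittingOnly? w H? k) (allVectors (suc n))
    ≡⟨ count-⇔ (hasWeightOmittingOnly? w H? k) _ split-first (allVectors (suc n)) ⟩
  count (λ x → R? (x fzero) (x ∘ fsuc)) (allVectors (suc n))
    ≡⟨ count-allVectors-suc R? ⟩
  count (R? false) V + count (R? true) V
    ≡⟨ cong₂ _+_ first-omitted first-included ⟩
  (if does (H? fzero) then count (P? k) V else 0) + count (P? (k - + w fzero)) V
    ≡⟨ cong₂ _+_ (cong (λ z → if does (H? fzero) then z else 0) (ih k)) (ih (k - + w fzero)) ⟩
  (if does (H? fzero) then 𝟙 k + L k else 0) + (𝟙 (k - + w fzero) + L (k - + w fzero))
    ≡⟨ rearrange ⟩
  𝟙 (k - + w fzero) + ((if does (H? fzero) then 𝟙 k else 0) + (L k + L (k - + w fzero)))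
    ≡⟨ sym (cong₂ _+_ (indicator-⇔ (x+y≡t⇔y≡t-x (+ w fzero) (+ sumFin (w ∘ fsuc)) k)
                                   (+ sumFin w ℤ.≟ k) (+ sumFin (w ∘ fsuc) ℤ.≟ k - + w fzero))
                      (lastOmittedCount-suc w H? k)) ⟩
  indicator (+ sumFin w ℤ.≟ k) + lastOmittedCount w H? k
    ∎
  where
  open ≡-Reasoning
  V = allVectors n
  H′? = H? ∘ fsuc
  P? = hasWeightOmittingOnly? (w ∘ fsuc) H′?
  𝟙 = λ t → indicator (+ sumFin (w ∘ fsuc) ℤ.≟ t)
  L = lastOmittedCount (w ∘ fsuc) H′?

  ih : ∀ t → count (P? t) V ≡ 𝟙 t + L t
  ih = count-hasWeightOmittingOnly (w ∘ fsuc) H′? (λ i j i≤j → closed (fsuc i) (fsuc j) (s≤s i≤j))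

  R? : ∀ b → Decidable _
  R? b y = ((b ≟ᵇ false) →-dec H? fzero)
           ×-dec (+ ((if b then w fzero else 0) + weight (w ∘ fsuc) y) ℤ.≟ k) ×-dec omitsOnly? H′? y

  split-first : ∀ x → HasWeightOmittingOnly w H k x ⇔ _
  split-first x = mk⇔ (λ (eq , omits) → omits fzero , eq , omits ∘ fsuc)
                      (λ (omits₀ , eq , omits′) → eq , ∀-cons omits₀ omits′)

  first-omitted : count (R? false) V ≡ (if does (H? fzero) then count (P? k) V else 0)
  first-omitted = trans (count-⇔ (R? false) (λ y → H? fzero ×-dec P? k y)
                                 (λ y → mk⇔ (λ (h , rest) → h refl , rest) (λ (h , rest) → (λ _ → h) , rest)) V)
                        (count-const-× (H? fzero) (P? k) V)

  first-included : count (R? true) V ≡ count (P? (k - + w fzero)) V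
  first-included = count-⇔ (R? true) (P? (k - + w fzero))
    (λ y → mk⇔ (λ (_ , eq , omits) → to (x+y≡t⇔y≡t-x (+ w fzero) _ k) eq , omits)
               (λ (eq , omits) → (λ ()) , from (x+y≡t⇔y≡t-x (+ w fzero) _ k) eq , omits)) V

  rearrange : (if does (H? fzero) then 𝟙 k + L k else 0) + (𝟙 (k - + w fzero) + L (k - + w fzero))
            ≡ 𝟙 (k - + w fzero) + ((if does (H? fzero) then 𝟙 k else 0) + (L k + L (k - + w fzero)))
  rearrange with H? fzero
  ... | yes _  = interchange (𝟙 k) (L k) (𝟙 (k - + w fzero)) (L (k - + w fzero))
    where
    interchange : ∀ a b c d → (a + b) + (c + d) ≡ c + (a + (b + d))
    interchange = solve-∀
  ... | no ¬h  = cong (λ z → 𝟙 (k - + w fzero) + (z + L (k - + w fzero)))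
                      (sym (lastOmittedCount-none (w ∘ fsuc) H′? (λ i → ¬h ∘ closed fzero (fsuc i) z≤n) k))

doesNotFit-prefixClosed : ∀ {n} {w : Fin n → ℕ} {c k : ℕ}
  → (∀ i j → toℕ i ≤ toℕ j → w j ≤ w i) → PrefixClosed (λ i → ¬ (w i + k ≤ c))
doesNotFit-prefixClosed {k = k} non-increasing i j i≤j wj+k≰c wi+k≤c =
  wj+k≰c (≤-trans (+-monoˡ-≤ k (non-increasing i j i≤j)) wi+k≤c)

isIMS-weight-⇔ : ∀ {n} {w : Fin n → ℕ} {c k : ℕ} {x : Fin n → Bool} → k ≤ c
  → (IsIMS w c x × weight w x ≡ k) ⇔ HasWeightOmittingOnly w (λ j → ¬ (w j + k ≤ c)) (+ k) x
isIMS-weight-⇔ {w = w} {c} {x = x} k≤c = mk⇔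
  (λ { ((_ , maximal) , refl) → refl , maximal })
  (λ (eq , omits) → isIMS-of-weight (+-injective eq) k≤c omits)
  where
  isIMS-of-weight : ∀ {k} → weight w x ≡ k → k ≤ c → OmitsOnly (λ j → ¬ (w j + k ≤ c)) x
    → IsIMS w c x × weight w x ≡ k
  isIMS-of-weight refl k≤c maximal = (k≤c , maximal) , refl

¬m+k≤c⇔c+1∸m≤k : ∀ {m k c} → k ≤ c → (¬ (m + k ≤ c)) ⇔ (c + 1 ∸ m ≤ k × k ≤ c)
¬m+k≤c⇔c+1∸m≤k {m} {k} {c} k≤c = mk⇔
  (λ m+k≰c → m≤n+o⇒m∸n≤o (c + 1) m (subst (_≤ m + k) (+-comm 1 c) (≰⇒> m+k≰c)) , k≤c)
  (λ (c+1∸m≤k , _) m+k≤c →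
     m+1+n≰m c (≤-trans (≤-trans (m≤n+m∸n (c + 1) m) (+-monoʳ-≤ m c+1∸m≤k)) m+k≤c))

theorem1 : (n c : ℕ) (w : Fin n → ℕ)
    → 1 ≤ c
    → (∀ i → 1 ≤ w i)
    → (∀ i j → toℕ i ≤ toℕ j → w j ≤ w i)
    → c < sumFin w
    → (∀ i → w i ≤ c)
    → (k : ℕ) → 1 ≤ k → k ≤ c
    → numberIMSWeight w c k
      ≡ sumFin (λ i → if ⌊ (c + 1 ∸ w i ≤ℕ? k) ×-dec (k ≤ℕ? c) ⌋
                      then numberSubsetsWeight w i (+ k - + tailSum w i)
                      else 0)
theorem1 n c w _ _ non-increasing c<Σw _ k _ k≤c = begin
  numberIMSWeight w c k
    ≡⟨ count-⇔ _ (hasWeightOmittingOnly? w doesNotFit? (+ k)) (λ _ → isIMS-weight-⇔ k≤c) (allVectors n) ⟩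
  count (hasWeightOmittingOnly? w doesNotFit? (+ k)) (allVectors n)
    ≡⟨ count-hasWeightOmittingOnly w doesNotFit? (doesNotFit-prefixClosed non-increasing) (+ k) ⟩
  indicator (+ sumFin w ℤ.≟ + k) + lastOmittedCount w doesNotFit? (+ k)
    ≡⟨ cong (λ b → (if b then 1 else 0) + lastOmittedCount w doesNotFit? (+ k))
            (dec-false (+ sumFin w ℤ.≟ + k) Σw≢k) ⟩
  lastOmittedCount w doesNotFit? (+ k)
    ≡⟨ sumFin-cong (λ i → cong (λ b → if b then numberSubsetsWeight w i (+ k - + tailSum w i) else 0)
                               (trans (does-⇔ (¬m+k≤c⇔c+1∸m≤k k≤c) (doesNotFit? i) (inWindow? i)) (sym (isYes≗does (inWindow? i))))) ⟩
  sumFin (λ i → if ⌊ (c + 1 ∸ w i ≤ℕ? k) ×-dec (k ≤ℕ? c) ⌋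
                then numberSubsetsWeight w i (+ k - + tailSum w i)
                else 0)
    ∎
  where
  open ≡-Reasoning
  doesNotFit? = λ i → ¬? (w i + k ≤ℕ? c)
  inWindow? = λ i → (c + 1 ∸ w i ≤ℕ? k) ×-dec (k ≤ℕ? c)
  Σw≢k : ¬ (+ sumFin w ≡ + k)
  Σw≢k eq = <⇒≱ c<Σw (subst (_≤ c) (sym (+-injective eq)) k≤c)
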